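{- Let $A = (\Sigma, Q, \delta, q_0, F)$ be a nondeterministic Büchi automaton over $\Sigma = 2^V$, in which every state and transition lies on some accepting run, and let $z \in V$, $Y = V \setminus \{z\}$. Consider the procedure that (i) computes the set $P \subseteq Q \times Q$ as the least set containing $(q_0,q_0)$ and such that whenever $(s_i,s_j) \in P$ and there is a letter $\sigma \in \Sigma$ with $s_i' \in \delta(s_i,\sigma)$ and $s_j' \in \delta(s_j,\sigma)$, then $(s_i',s_j') \in P$ (computed by a worklist exploration from $(q_0,q_0)$); and (ii) returns False if there exist $(p,q) \in P$ and letters $\sigma_p, \sigma_q \in \Sigma$ with $\delta(p,\sigma_p) \neq \emptyset$, $\delta(q,\sigma_q) \neq \emptyset$, $\sigma_p.Y = \sigma_q.Y$ and $\sigma_p.\{z\} \neq \sigma_q.\{z\}$, and returns True otherwise. This procedure returns True if and only if $\{z\}$ is automata dependent on $V \setminus \{z\}$ in $A$.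
   Context: For a letter $a \in 2^V$ (an assignment to $V$) and $Z \subseteq V$, $a.Z$ is the restriction of $a$ to $Z$. A pair of states $(s,s')$ is compatible in $A$ if there is a finite word $u$ with runs from $q_0$ to $s$ and from $q_0$ to $s'$ both reading $u$. For $X, Y \subseteq V$, $X$ is automata dependent on $Y$ in $A$ if for every compatible pair $(s,s')$ and all letters $\sigma,\sigma'$ with $\sigma.Y = \sigma'.Y$ and $\sigma.X \neq \sigma'.X$, not both $\delta(s,\sigma) \neq \emptyset$ and $\delta(s',\sigma') \neq \emptyset$. -}

module Defs where

open import Data.Nat using (ℕ; zero; suc; _≤_)
open import Data.Bool using (Bool; true; false; T)
open import Data.Fin using (Fin)
open import Data.Fin.Subset using (Subset; _∩_; ⁅_⁆; ∁)
open import Data.List using (List; []; _∷_)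
open import Data.Product using (Σ; ∃; _×_; _,_)
open import Relation.Nullary using (¬_)
open import Relation.Binary.PropositionalEquality using (_≡_; _≢_)

-- The variable set V is Fin n; a letter of Σ = 2^V is a subset of V
-- (an assignment: the set of variables that are true).
Letter : ℕ → Set
Letter n = Subset n

_∙_ : ∀ {n} → Letter n → Subset n → Subset n
a ∙ Z = a ∩ Z

record NBA (n : ℕ) : Set where
  field
    states : ℕ
    δ      : Fin states → Letter n → Fin states → Bool   -- s' ∈ δ(s,σ) iff δ s σ s' ≡ true
    q₀     : Fin states
    F      : Fin states → Bool

module _ {n : ℕ} (A : NBA n) where
  open NBA A

  Q : Set
  Q = Fin states

  Enabled : Q → Letter n → Set
  Enabled s σ = ∃ λ s' → T (δ s σ s')

  data Path : Q → List (Letter n) → Q → Set where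
    nil  : ∀ {s} → Path s [] s
    step : ∀ {s σ s' u t} → T (δ s σ s') → Path s' u t → Path s (σ ∷ u) t

  Compatible : Q → Q → Set
  Compatible s s' = ∃ λ u → Path q₀ u s × Path q₀ u s'

  AutDep : Subset n → Subset n → Set
  AutDep X Y = ∀ s s' → Compatible s s' → ∀ (σ σ' : Letter n) →
    σ ∙ Y ≡ σ' ∙ Y → σ ∙ X ≢ σ' ∙ X → ¬ (Enabled s σ × Enabled s' σ')

  IsRun : (ℕ → Letter n) → (ℕ → Q) → Set
  IsRun w r = (r 0 ≡ q₀) × (∀ i → T (δ (r i) (w i) (r (suc i))))

  AcceptingRun : (ℕ → Letter n) → (ℕ → Q) → Set
  AcceptingRun w r = IsRun w r × (∀ i → ∃ λ j → i ≤ j × T (F (r j)))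

  Trim : Set
  Trim =
    (∀ q → ∃ λ w → ∃ λ r → AcceptingRun w r × ∃ λ i → r i ≡ q) ×
    (∀ s σ s' → T (δ s σ s') →
       ∃ λ w → ∃ λ r → AcceptingRun w r × ∃ λ i →
         (r i ≡ s) × (w i ≡ σ) × (r (suc i) ≡ s'))

  data InP : Q → Q → Set where
    init : InP q₀ q₀
    step : ∀ {si sj si' sj'} (σ : Letter n) → InP si sj →
           T (δ si σ si') → T (δ sj σ sj') → InP si' sj'

  ReturnsFalse : Fin n → Set
  ReturnsFalse z = ∃ λ p → ∃ λ q → InP p q × ∃ λ (σp : Letter n) → ∃ λ (σq : Letter n) →
    Enabled p σp × Enabled q σq ×
    (σp ∙ ∁ ⁅ z ⁆ ≡ σq ∙ ∁ ⁅ z ⁆) × (σp ∙ ⁅ z ⁆ ≢ σq ∙ ⁅ z ⁆)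

  ReturnsTrue : Fin n → Set
  ReturnsTrue z = ¬ ReturnsFalse z

{-# OPTIONS --safe #-}
module Submission where

-- P is exactly the set of compatible pairs: a derivation of (p, q) ∈ P is a
-- path from (q₀, q₀) in the product automaton, i.e. one word read by a run to p
-- and by a run to q. With that, the condition under which the procedure
-- returns False is literally the negation of automata dependency.

open import Defs
open import Data.Nat using (ℕ)
open import Data.Bool using (T)
open import Data.Fin using (Fin)
open import Data.Fin.Subset using (⁅_⁆; ∁)
open import Data.List using ([]; _∷ʳ_)
open import Data.Product using (_,_)
open import Function.Bundles using (_⇔_; mk⇔)

module _ {n : ℕ} (A : NBA n) where
  open NBA A

  Path-∷ʳ : ∀ {s u t σ t'} → Path A s u t → T (δ t σ t') → Path A s (u ∷ʳ σ) t'
  Path-∷ʳ nil              t→t' = step t→t' nil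
  Path-∷ʳ (step s→s₁ s₁→t) t→t' = step s→s₁ (Path-∷ʳ s₁→t t→t')

  InP⇒Compatible : ∀ {p q} → InP A p q → Compatible A p q
  InP⇒Compatible init = [] , nil , nil
  InP⇒Compatible (step σ pq p→p' q→q') with InP⇒Compatible pq
  ... | u , q₀→p , q₀→q = u ∷ʳ σ , Path-∷ʳ q₀→p p→p' , Path-∷ʳ q₀→q q→q'

  InP-closed-under-Path : ∀ {p q u p' q'} →
    InP A p q → Path A p u p' → Path A q u q' → InP A p' q'
  InP-closed-under-Path pq nil nil = pq
  InP-closed-under-Path pq (step {σ = σ} p→p₁ p₁→p') (step q→q₁ q₁→q') =
    InP-closed-under-Path (step σ pq p→p₁ q→q₁) p₁→p' q₁→q'

  Compatible⇒InP : ∀ {p q} → Compatible A p q → InP A p q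
  Compatible⇒InP (_ , q₀→p , q₀→q) = InP-closed-under-Path init q₀→p q₀→q

lemma1 : ∀ {n : ℕ} (A : NBA n) → Trim A → (z : Fin n) →
    ReturnsTrue A z ⇔ AutDep A ⁅ z ⁆ (∁ ⁅ z ⁆)
lemma1 A _ z = mk⇔ returnsTrue⇒autDep autDep⇒returnsTrue
  where
  returnsTrue⇒autDep : ReturnsTrue A z → AutDep A ⁅ z ⁆ (∁ ⁅ z ⁆)
  returnsTrue⇒autDep noWitness s s' compat σ σ' sameY differentZ (en , en') =
    noWitness (s , s' , Compatible⇒InP A compat , σ , σ' , en , en' , sameY , differentZ)

  autDep⇒returnsTrue : AutDep A ⁅ z ⁆ (∁ ⁅ z ⁆) → ReturnsTrue A z
  autDep⇒returnsTrue dep (p , q , pq , σp , σq , en , en' , sameY , differentZ) =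
    dep p q (InP⇒Compatible A pq) σp σq sameY differentZ (en , en')
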